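{- Let $n$ be a positive integer and let $r$ be a positive even integer with $r \le \frac{2n}{3}$. Then there is a triangle-free subset of the $r$-distance graph of the $n$-dimensional hypercube of size at least $$\frac{c\,2^n}{\sqrt{\binom{n}{r}\binom{r}{r/2}\binom{n-r}{r/2}}}, \qquad \text{where } c = \frac{2\sqrt{2}}{3}.$$
   Context: The $n$-dimensional hypercube has vertex set $\{0,1\}^n$. The Hamming distance of two $0$--$1$ sequences of the same length is the number of positions in which they differ. The $r$-distance graph of the $n$-dimensional hypercube is the graph on $\{0,1\}^n$ in which two vertices are adjacent if and only if their Hamming distance is exactly $r$. A subset of the vertices is triangle-free if it contains no three vertices that are pairwise at Hamming distance exactly $r$. -}

module Defs where

open import Data.Nat using (ℕ; zero; suc; _+_)
open import Data.Bool using (Bool; true; false)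
open import Data.Vec using (Vec; []; _∷_)
open import Data.List using (List)
open import Data.List.Membership.Propositional using (_∈_)
open import Data.Product using (_×_)
open import Relation.Binary.PropositionalEquality using (_≡_)
open import Relation.Nullary using (¬_)

Vertex : ℕ → Set
Vertex n = Vec Bool n

bdiff : Bool → Bool → ℕ
bdiff true  true  = 0
bdiff false false = 0
bdiff true  false = 1
bdiff false true  = 1

hamming : ∀ {n} → Vec Bool n → Vec Bool n → ℕ
hamming []       []       = 0
hamming (x ∷ xs) (y ∷ ys) = bdiff x y + hamming xs ys

Adj : ∀ {n} → ℕ → Vertex n → Vertex n → Set
Adj r x y = hamming x y ≡ r

TriangleFree : ∀ {n} → ℕ → List (Vertex n) → Set
TriangleFree {n} r S =
  ∀ (x y z : Vertex n) → x ∈ S → y ∈ S → z ∈ S →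
  ¬ (Adj r x y × Adj r y z × Adj r x z)

{-# OPTIONS --safe #-}
-- Every vertex of the cube lies in N = C(n,r) C(r,r/2) C(n-r,r/2) ordered triangles of the
-- r-distance graph, so there are t = 2ⁿ N of them. Repeatedly deleting a vertex of maximal
-- triangle degree until no triangle is left destroys, at each step, at least the fraction
-- 3/|U| of the remaining triangles, which is what a uniformly random vertex would do on
-- average. This derandomises the alteration method: for every m, at least
-- m - t (m)₃ / (6 (2ⁿ)₃) vertices survive, the expected number of vertices of a random
-- m-set minus one vertex for each of its triangles. Taking m ≈ 2ⁿ √(2/N) leaves at least
-- 2m/3 ≈ (2√2/3) 2ⁿ/√N vertices; when 9N ≥ 2·4ⁿ, the two vertices that always survive
-- already suffice.

module Submission where

open import Defs
open import Algebra.Properties.CommutativeSemigroup as CommSemigroupProperties using ()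
open import Data.Bool using (true; false; not)
open import Data.List using (List; []; _∷_; _++_; [_]; map; length)
open import Data.List.Properties using (length-++; length-map; map-++; map-cong; map-∘)
open import Data.List.Membership.Propositional using (_∈_)
open import Data.List.Membership.Propositional.Properties using (∈-map⁻; ∈-∃++)
open import Data.List.Relation.Unary.Any using (here; there)
open import Data.List.Relation.Unary.All using ([])
open import Data.List.Relation.Unary.AllPairs using ([]; _∷_)
open import Data.List.Relation.Unary.Unique.Propositional using (Unique)
import Data.List.Relation.Unary.Unique.Propositional.Properties as Unique
open import Data.List.Relation.Binary.Permutation.Propositional using (_↭_; ↭-sym)
import Data.List.Relation.Binary.Permutation.Propositional.Properties as ↭
open import Data.List.Relation.Binary.Sublist.Propositional using (_⊆_; []; _∷_; _∷ʳ_; ⊆-refl; ⊆-trans)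
open import Data.List.Relation.Binary.Sublist.Propositional.Properties using (++⁺; All-resp-⊆)
open import Data.Nat
open import Data.Nat.Properties
open import Data.Nat.Combinatorics using (_C_; _P_; nCk+nC[k+1]≡[n+1]C[k+1]; nC1≡n)
open import Data.Nat.Induction using (<-wellFounded)
open import Data.Nat.ListAction using (sum)
open import Data.Nat.ListAction.Properties using (sum-++; sum-↭)
open import Data.Nat.Tactic.RingSolver using (solve-∀)
open import Data.Product using (Σ; ∃; _×_; _,_; proj₁; proj₂)
open import Data.Sum using (_⊎_; inj₁; inj₂)
open import Data.Unit using (tt)
open import Data.Vec using ([]; _∷_)
open import Data.Vec.Properties using (∷-injectiveʳ)
open import Function using (_∘_)
open import Induction.WellFounded using (Acc; acc)
open import Relation.Nullary using (¬_; yes; no; contradiction)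
open import Relation.Unary using (Decidable)
open import Relation.Binary.PropositionalEquality
  using (_≡_; _≢_; refl; sym; trans; cong; cong₂; subst; subst₂; module ≡-Reasoning)

open CommSemigroupProperties +-commutativeSemigroup
  using () renaming (interchange to +-interchange; x∙yz≈y∙xz to x+[y+z]≡y+[x+z])

-- Sums over lists and sublists

∑ : {A : Set} → List A → (A → ℕ) → ℕ
∑ xs f = sum (map f xs)

syntax ∑ xs (λ x → e) = ∑[ x ∈ xs ] e

module _ {A : Set} where

  ∑-++ : ∀ (xs ys : List A) f → ∑ (xs ++ ys) f ≡ ∑ xs f + ∑ ys f
  ∑-++ xs ys f = trans (cong sum (map-++ f xs ys)) (sum-++ (map f xs) (map f ys))

  ∑-↭ : ∀ {xs ys : List A} f → xs ↭ ys → ∑ xs f ≡ ∑ ys f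
  ∑-↭ f p = sum-↭ (↭.map⁺ f p)

  ∑-map : ∀ {B : Set} (g : A → B) xs f → ∑ (map g xs) f ≡ ∑[ x ∈ xs ] f (g x)
  ∑-map g xs f = cong sum (sym (map-∘ xs))

  ∑-cong : ∀ (xs : List A) {f g} → (∀ x → f x ≡ g x) → ∑ xs f ≡ ∑ xs g
  ∑-cong xs f≗g = cong sum (map-cong f≗g xs)

  ∑-zero : ∀ (xs : List A) {f} → (∀ x → f x ≡ 0) → ∑ xs f ≡ 0
  ∑-zero []       f≗0 = refl
  ∑-zero (x ∷ xs) f≗0 = cong₂ _+_ (f≗0 x) (∑-zero xs f≗0)

  ∑-+ : ∀ (xs : List A) f g → ∑[ x ∈ xs ] (f x + g x) ≡ ∑ xs f + ∑ xs g
  ∑-+ []       f g = refl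
  ∑-+ (x ∷ xs) f g = trans (cong (f x + g x +_) (∑-+ xs f g)) (+-interchange (f x) (g x) _ _)

  ∑-*ˡ : ∀ (xs : List A) c f → ∑[ x ∈ xs ] (c * f x) ≡ c * ∑ xs f
  ∑-*ˡ []       c f = sym (*-zeroʳ c)
  ∑-*ˡ (x ∷ xs) c f = trans (cong (c * f x +_) (∑-*ˡ xs c f)) (sym (*-distribˡ-+ c (f x) _))

  ∑-const : ∀ (xs : List A) c → ∑[ _ ∈ xs ] c ≡ length xs * c
  ∑-const []       c = refl
  ∑-const (x ∷ xs) c = cong (c +_) (∑-const xs c)

  ∈⇒≤∑ : ∀ f {x} {xs : List A} → x ∈ xs → f x ≤ ∑ xs f
  ∈⇒≤∑ f (here refl)              = m≤m+n _ _
  ∈⇒≤∑ f {xs = y ∷ _} (there x∈) = ≤-trans (∈⇒≤∑ f x∈) (m≤n+m _ (f y))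

  ∑∑-symmetric-even : ∀ (g : A → A → ℕ) → (∀ y z → g y z ≡ g z y) → (∀ y → g y y ≡ 0) →
    ∀ ys → ∃ λ h → ∑[ y ∈ ys ] ∑[ z ∈ ys ] g y z ≡ 2 * h
  ∑∑-symmetric-even g g-sym g-diag []       = 0 , refl
  ∑∑-symmetric-even g g-sym g-diag (a ∷ ys) with ∑∑-symmetric-even g g-sym g-diag ys
  ... | h , ∑∑≡2h = s + h , (begin
    (g a a + s) + ∑[ y ∈ ys ] (g y a + ∑[ z ∈ ys ] g y z)
      ≡⟨ cong₂ _+_ (cong (_+ s) (g-diag a)) (∑-+ ys (λ y → g y a) _) ⟩
    s + (∑[ y ∈ ys ] g y a + ∑[ y ∈ ys ] ∑[ z ∈ ys ] g y z)
      ≡⟨ cong₂ (λ p q → s + (p + q)) (∑-cong ys (λ y → g-sym y a)) ∑∑≡2h ⟩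
    s + (s + 2 * h)
      ≡⟨ twice s h ⟩
    2 * (s + h) ∎)
    where
    open ≡-Reasoning
    s = ∑ ys (g a)
    twice : ∀ s h → s + (s + 2 * h) ≡ 2 * (s + h)
    twice = solve-∀

  ∃-≥-average : ∀ f (x : A) xs → ∃ λ v → v ∈ x ∷ xs × ∑ (x ∷ xs) f ≤ length (x ∷ xs) * f v
  ∃-≥-average f x []       = x , here refl , ≤-refl
  ∃-≥-average f x (y ∷ xs) with ∃-≥-average f y xs
  ... | v , v∈ , ∑≤ with f v ≤? f x
  ...   | yes fv≤fx = x , here refl , +-monoʳ-≤ (f x) (≤-trans ∑≤ (*-monoʳ-≤ (length (y ∷ xs)) fv≤fx))
  ...   | no  fv≰fx = v , there v∈ , +-mono-≤ (<⇒≤ (≰⇒> fv≰fx)) ∑≤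

Unique-⊆ : ∀ {A : Set} {xs ys : List A} → xs ⊆ ys → Unique ys → Unique xs
Unique-⊆ []             []         = []
Unique-⊆ (_ ∷ʳ xs⊆ys)   (_ ∷ !ys)  = Unique-⊆ xs⊆ys !ys
Unique-⊆ (refl ∷ xs⊆ys) (y∉ ∷ !ys) = All-resp-⊆ xs⊆ys y∉ ∷ Unique-⊆ xs⊆ys !ys

-- Indicators

δ : ℕ → ℕ → ℕ
δ zero    zero    = 1
δ zero    (suc b) = 0
δ (suc a) zero    = 0
δ (suc a) (suc b) = δ a b

_IsIndicatorOf_ : ℕ → Set → Set
n IsIndicatorOf P = (P × n ≡ 1) ⊎ (¬ P × n ≡ 0)

δ-indicator : ∀ a b → δ a b IsIndicatorOf (a ≡ b)
δ-indicator zero    zero    = inj₁ (refl , refl)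
δ-indicator zero    (suc b) = inj₂ ((λ ()) , refl)
δ-indicator (suc a) zero    = inj₂ ((λ ()) , refl)
δ-indicator (suc a) (suc b) with δ-indicator a b
... | inj₁ (a≡b , δ≡1) = inj₁ (cong suc a≡b , δ≡1)
... | inj₂ (a≢b , δ≡0) = inj₂ (a≢b ∘ suc-injective , δ≡0)

*-indicator : ∀ {m n P Q} → m IsIndicatorOf P → n IsIndicatorOf Q → (m * n) IsIndicatorOf (P × Q)
*-indicator (inj₁ (p , refl)) (inj₁ (q , refl)) = inj₁ ((p , q) , refl)
*-indicator (inj₁ (p , refl)) (inj₂ (¬q , refl)) = inj₂ (¬q ∘ proj₂ , refl)
*-indicator (inj₂ (¬p , refl)) _                 = inj₂ (¬p ∘ proj₁ , refl)

indicator-unique : ∀ {m n P Q} → m IsIndicatorOf P → n IsIndicatorOf Q → (P → Q) → (Q → P) → m ≡ n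
indicator-unique (inj₁ (_ , refl)) (inj₁ (_ , refl)) _   _   = refl
indicator-unique (inj₁ (p , _))    (inj₂ (¬q , _))   P→Q _   = contradiction (P→Q p) ¬q
indicator-unique (inj₂ (¬p , _))   (inj₁ (q , _))    _   Q→P = contradiction (Q→P q) ¬p
indicator-unique (inj₂ (_ , refl)) (inj₂ (_ , refl)) _   _   = refl

δ-refl : ∀ a → δ a a ≡ 1
δ-refl zero    = refl
δ-refl (suc a) = δ-refl a

-- Greedy deletion

falling³-suc : ∀ u → (u P 3) * suc u ≡ (suc u P 3) * (u ∸ 2)
falling³-suc 0 = refl
falling³-suc 1 = refl
falling³-suc 2 = refl
falling³-suc (suc (suc (suc c))) = expanded c
  where
  expanded : ∀ c → (1 + c) * ((2 + c) * ((3 + c) * 1)) * (4 + c) ≡ (2 + c) * ((3 + c) * ((4 + c) * 1)) * (1 + c)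
  expanded = solve-∀

-- Divided out, `sampled` reads s ≥ m - t (m)₃ / (6 (V)₃).
record DeletionBound (V t s : ℕ) : Set where
  field
    keeps-pair : 2 ≤ V → 2 ≤ s
    linear     : 6 * V ≤ 6 * s + t
    sampled    : ∀ m → 3 ≤ m → m ≤ V → 6 * m * (V P 3) ≤ 6 * s * (V P 3) + t * (m P 3)

deletionBound-keep-all : ∀ V t → DeletionBound V t V
deletionBound-keep-all V t = record
  { keeps-pair = λ 2≤V → 2≤V
  ; linear     = m≤m+n (6 * V) t
  ; sampled    = λ m _ m≤V → ≤-trans (*-monoˡ-≤ (V P 3) (*-monoʳ-≤ 6 m≤V)) (m≤m+n _ _)
  }

sampled-step : ∀ {u s t t′ d m} → 3 ≤ u → t ≡ 3 * d + t′ → t ≤ suc u * d →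
  6 * m * (u P 3) ≤ 6 * s * (u P 3) + t′ * (m P 3) →
  6 * m * (suc u P 3) ≤ 6 * s * (suc u P 3) + t * (m P 3)
sampled-step {u@(suc (suc (suc c)))} {s} {t} {t′} {d} {m} (s≤s (s≤s (s≤s z≤n))) t≡ t≤ sampled-u =
  *-cancelˡ-≤ (1 + c) (begin
    (1 + c) * (6 * m * B)                      ≡⟨ regroup (1 + c) m B ⟩
    6 * m * (B * (1 + c))                      ≡⟨ cong (6 * m *_) (falling³-suc u) ⟨
    6 * m * (A * (4 + c))                      ≡⟨ *-assoc (6 * m) A (4 + c) ⟨
    6 * m * A * (4 + c)                        ≤⟨ *-monoˡ-≤ (4 + c) sampled-u ⟩
    (6 * s * A + t′ * p) * (4 + c)             ≡⟨ distribute (4 + c) s A t′ p ⟩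
    6 * s * (A * (4 + c)) + t′ * (4 + c) * p   ≡⟨ cong (λ x → 6 * s * x + t′ * (4 + c) * p) (falling³-suc u) ⟩
    6 * s * (B * (1 + c)) + t′ * (4 + c) * p   ≤⟨ +-monoʳ-≤ (6 * s * (B * (1 + c))) (*-monoˡ-≤ p t′-shrinks) ⟩
    6 * s * (B * (1 + c)) + t * (1 + c) * p    ≡⟨ collect (1 + c) s B t p ⟩
    (1 + c) * (6 * s * B + t * p)              ∎)
  where
  open ≤-Reasoning
  A = u P 3
  B = suc u P 3
  p = m P 3
  regroup : ∀ k m B → k * (6 * m * B) ≡ 6 * m * (B * k)
  regroup = solve-∀
  distribute : ∀ k s A t′ p → (6 * s * A + t′ * p) * k ≡ 6 * s * (A * k) + t′ * k * p
  distribute = solve-∀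
  collect : ∀ k s B t p → 6 * s * (B * k) + t * k * p ≡ k * (6 * s * B + t * p)
  collect = solve-∀
  t′-shrinks : t′ * (4 + c) ≤ t * (1 + c)
  t′-shrinks = +-cancelʳ-≤ (3 * t) _ _ (begin
    t′ * (4 + c) + 3 * t             ≤⟨ +-monoʳ-≤ (t′ * (4 + c)) (*-monoʳ-≤ 3 (≤-trans t≤ (≤-reflexive (*-comm (4 + c) d)))) ⟩
    t′ * (4 + c) + 3 * (d * (4 + c)) ≡⟨ expand-removed c d t′ ⟩
    (3 * d + t′) * (4 + c)           ≡⟨ cong (_* (4 + c)) t≡ ⟨
    t * (4 + c)                      ≡⟨ split-off c t ⟩
    t * (1 + c) + 3 * t              ∎)
    where
    expand-removed : ∀ c d t′ → t′ * (4 + c) + 3 * (d * (4 + c)) ≡ (3 * d + t′) * (4 + c)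
    expand-removed = solve-∀
    split-off : ∀ c t → t * (4 + c) ≡ t * (1 + c) + 3 * t
    split-off = solve-∀

deletionBound-step : ∀ {u s t t′ d} → t ≡ 3 * d + t′ → t ≤ suc u * d → 2 ≤ d →
  DeletionBound u t′ s → DeletionBound (suc u) t s
deletionBound-step {u} {s} {t} {t′} {d} t≡ t≤ 2≤d bound = record
  { keeps-pair = λ _ → keeps-pair 2≤u
  ; linear     = linear′
  ; sampled    = sampled′
  }
  where
  open DeletionBound bound
  open ≤-Reasoning
  instance
    d≢0 : NonZero d
    d≢0 = >-nonZero (≤-trans (s≤s z≤n) 2≤d)
  2≤u : 2 ≤ u
  2≤u = ≤-pred (*-cancelʳ-≤ 3 (suc u) d (≤-trans (m≤m+n (3 * d) t′) (≤-trans (≤-reflexive (sym t≡)) t≤)))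
  linear′ : 6 * suc u ≤ 6 * s + t
  linear′ = begin
    6 * suc u            ≡⟨ *-suc 6 u ⟩
    6 + 6 * u            ≤⟨ +-mono-≤ (*-monoʳ-≤ 3 2≤d) linear ⟩
    3 * d + (6 * s + t′) ≡⟨ x+[y+z]≡y+[x+z] (3 * d) (6 * s) t′ ⟩
    6 * s + (3 * d + t′) ≡⟨ cong (6 * s +_) t≡ ⟨
    6 * s + t            ∎
  sampled′ : ∀ m → 3 ≤ m → m ≤ suc u → 6 * m * (suc u P 3) ≤ 6 * s * (suc u P 3) + t * (m P 3)
  sampled′ m 3≤m m≤1+u with m≤n⇒m<n∨m≡n m≤1+u
  ... | inj₁ (s≤s m≤u) = sampled-step {s = s} {m = m} (≤-trans 3≤m m≤u) t≡ t≤ (sampled m 3≤m m≤u)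
  ... | inj₂ refl      = ≤-trans (*-monoˡ-≤ (suc u P 3) linear′) (≤-reflexive (*-distribʳ-+ (suc u P 3) (6 * s) t))

module Deletion {X : Set} (T : X → X → X → ℕ)
  (T-swap₁₂ : ∀ x y z → T x y z ≡ T y x z)
  (T-swap₂₃ : ∀ x y z → T x y z ≡ T x z y)
  (T-diag : ∀ x z → T x x z ≡ 0)
  where

  T-diag₂₃ : ∀ x y → T x y y ≡ 0
  T-diag₂₃ x y = trans (T-swap₁₂ x y y) (trans (T-swap₂₃ y x y) (T-diag y x))

  T-diag₁₃ : ∀ x y → T x y x ≡ 0
  T-diag₁₃ x y = trans (T-swap₂₃ x y x) (T-diag x y)

  T-rotate : ∀ x y z → T x y z ≡ T z x y
  T-rotate x y z = trans (T-swap₂₃ x y z) (T-swap₁₂ x z y)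

  degree : List X → X → ℕ
  degree U v = ∑[ y ∈ U ] ∑[ z ∈ U ] T v y z

  triangles : List X → ℕ
  triangles U = ∑ U (degree U)

  ∈⇒T≤triangles : ∀ {U x y z} → x ∈ U → y ∈ U → z ∈ U → T x y z ≤ triangles U
  ∈⇒T≤triangles {U} {x} {y} x∈U y∈U z∈U =
    ≤-trans (∈⇒≤∑ (T x y) z∈U) (≤-trans (∈⇒≤∑ (λ y → ∑ U (T x y)) y∈U) (∈⇒≤∑ (degree U) x∈U))

  degree-↭ : ∀ {U W} v → U ↭ W → degree U v ≡ degree W v
  degree-↭ {U} {W} v U↭W = trans (∑-↭ _ U↭W) (∑-cong W (λ y → ∑-↭ (T v y) U↭W))

  triangles-↭ : ∀ {U W} → U ↭ W → triangles U ≡ triangles W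
  triangles-↭ {W = W} U↭W = trans (∑-↭ _ U↭W) (∑-cong W (λ x → degree-↭ x U↭W))

  degree-even : ∀ U v → ∃ λ h → degree U v ≡ 2 * h
  degree-even U v = ∑∑-symmetric-even (T v) (T-swap₂₃ v) (T-diag₂₃ v) U

  degree-∷ : ∀ v W → degree (v ∷ W) v ≡ ∑[ y ∈ W ] ∑[ z ∈ W ] T v y z
  degree-∷ v W = cong₂ _+_ (∑-zero (v ∷ W) (T-diag v)) (∑-cong W (λ y → cong (_+ ∑ W (T v y)) (T-diag₁₃ v y)))

  triangles-∷ : ∀ v W → triangles (v ∷ W) ≡ 3 * degree (v ∷ W) v + triangles W
  triangles-∷ v W = begin
    d + ∑[ x ∈ W ] (∑[ z ∈ v ∷ W ] T x v z + ∑[ y ∈ W ] (T x y v + ∑[ z ∈ W ] T x y z))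
      ≡⟨ cong (d +_) (∑-+ W _ _) ⟩
    d + (∑[ x ∈ W ] ∑[ z ∈ v ∷ W ] T x v z + ∑[ x ∈ W ] ∑[ y ∈ W ] (T x y v + ∑[ z ∈ W ] T x y z))
      ≡⟨ cong (λ e → d + (∑[ x ∈ W ] ∑[ z ∈ v ∷ W ] T x v z + e)) (trans (∑-cong W (λ x → ∑-+ W _ _)) (∑-+ W _ _)) ⟩
    d + (∑[ x ∈ W ] ∑[ z ∈ v ∷ W ] T x v z + (∑[ x ∈ W ] ∑[ y ∈ W ] T x y v + triangles W))
      ≡⟨ cong₂ (λ p q → d + (p + (q + triangles W))) through-v-first through-v-last ⟩
    d + (d + (d + triangles W))
      ≡⟨ three-copies d (triangles W) ⟩
    3 * d + triangles W ∎
    where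
    open ≡-Reasoning
    d = degree (v ∷ W) v
    through-v-first : ∑[ x ∈ W ] ∑[ z ∈ v ∷ W ] T x v z ≡ d
    through-v-first = begin
      ∑[ x ∈ W ] ∑[ z ∈ v ∷ W ] T x v z   ≡⟨ ∑-cong W (λ x → ∑-cong (v ∷ W) (T-swap₁₂ x v)) ⟩
      ∑[ x ∈ W ] ∑[ z ∈ v ∷ W ] T v x z   ≡⟨ ∑-cong W (λ x → cong (_+ ∑ W (T v x)) (T-diag₁₃ v x)) ⟩
      ∑[ x ∈ W ] ∑[ z ∈ W ] T v x z       ≡⟨ degree-∷ v W ⟨
      d                                   ∎
    through-v-last : ∑[ x ∈ W ] ∑[ y ∈ W ] T x y v ≡ d
    through-v-last = trans (∑-cong W (λ x → ∑-cong W (λ y → T-rotate x y v))) (sym (degree-∷ v W))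
    three-copies : ∀ d t → d + (d + (d + t)) ≡ 3 * d + t
    three-copies = solve-∀

  ∃-heavy-vertex : ∀ U → triangles U ≢ 0 → ∃ λ v → v ∈ U × triangles U ≤ length U * degree U v
  ∃-heavy-vertex []      []-has-triangles = contradiction refl []-has-triangles
  ∃-heavy-vertex (u ∷ U) _                 = ∃-≥-average (degree (u ∷ U)) u U

  heavy-degree≥2 : ∀ {U v} → triangles U ≢ 0 → triangles U ≤ length U * degree U v → 2 ≤ degree U v
  heavy-degree≥2 {U} {v} U-not-free heavy with degree-even U v
  ... | suc h , d≡2h = subst (2 ≤_) (sym d≡2h) (*-monoʳ-≤ 2 (s≤s z≤n))
  ... | zero  , d≡0  = contradiction (n≤0⇒n≡0 (≤-trans heavy |U|*d≡0)) U-not-free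
    where
    |U|*d≡0 : length U * degree U v ≤ 0
    |U|*d≡0 = ≤-reflexive (trans (cong (length U *_) d≡0) (*-zeroʳ (length U)))

  Survivors : List X → Set
  Survivors U = ∃ λ S → S ⊆ U × triangles S ≡ 0 × DeletionBound (length U) (triangles U) (length S)

  length-removed : ∀ A (v : X) B → length (A ++ [ v ] ++ B) ≡ suc (length (A ++ B))
  length-removed A v B = ↭.↭-length (↭.shift v A B)

  survivors-after-removal : ∀ A v B → let U = A ++ [ v ] ++ B in
    triangles U ≢ 0 → triangles U ≤ length U * degree U v → Survivors (A ++ B) → Survivors U
  survivors-after-removal A v B U-not-free heavy (S , S⊆W , S-free , bound) =
    S , ⊆-trans S⊆W (++⁺ ⊆-refl (v ∷ʳ ⊆-refl)) , S-free ,
    subst (λ V → DeletionBound V (triangles U) (length S)) (sym |U|≡)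
      (deletionBound-step removal (subst (λ V → triangles U ≤ V * degree U v) |U|≡ heavy)
        (heavy-degree≥2 {U} {v} U-not-free heavy) bound)
    where
    U = A ++ [ v ] ++ B
    W = A ++ B
    U↭v∷W : U ↭ v ∷ W
    U↭v∷W = ↭.shift v A B
    |U|≡ : length U ≡ suc (length W)
    |U|≡ = length-removed A v B
    removal : triangles U ≡ 3 * degree U v + triangles W
    removal = trans (triangles-↭ U↭v∷W)
      (trans (triangles-∷ v W) (cong (λ d → 3 * d + triangles W) (degree-↭ v (↭-sym U↭v∷W))))

  deletion : ∀ U → Survivors U
  deletion U = delete U (<-wellFounded (length U))
    where
    delete : ∀ U → Acc _<_ (length U) → Survivors U
    delete U (acc shorter) with triangles U ≟ 0
    ... | yes U-free = U , ⊆-refl , U-free , deletionBound-keep-all (length U) (triangles U)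
    ... | no U-not-free with ∃-heavy-vertex U U-not-free
    ...   | v , v∈U , heavy with ∈-∃++ v∈U
    ...     | A , B , refl = survivors-after-removal A v B U-not-free heavy
                               (delete (A ++ B) (shorter (≤-reflexive (sym (length-removed A v B)))))

-- Choosing the sample size

falling³-nonZero : ∀ {V} → 3 ≤ V → NonZero (V P 3)
falling³-nonZero (s≤s (s≤s (s≤s _))) = _

-- m ≈ V √(2/N), the sample size at which `sampled` yields s ≥ 2m/3.
record SampleSize (V N : ℕ) : Set where
  field
    m      : ℕ
    3≤m    : 3 ≤ m
    m≤V    : m ≤ V
    covers : 2 * (V * V) ≤ N * (m * m)
    sparse : V * N * (m P 3) ≤ 2 * m * (V P 3)

deletion-size-bound : ∀ {V N s} → DeletionBound V (V * N) s → SampleSize V N → 8 * (V * V) ≤ 9 * (s * s) * N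
deletion-size-bound {V} {N} {s} bound sample = begin
  8 * (V * V)             ≡⟨ *-assoc 4 2 (V * V) ⟩
  4 * (2 * (V * V))       ≤⟨ *-monoʳ-≤ 4 covers ⟩
  4 * (N * (m * m))       ≡⟨ double-square N m ⟩
  N * ((2 * m) * (2 * m)) ≤⟨ *-monoʳ-≤ N (*-mono-≤ 2m≤3s 2m≤3s) ⟩
  N * ((3 * s) * (3 * s)) ≡⟨ triple-square N s ⟩
  9 * (s * s) * N         ∎
  where
  open ≤-Reasoning
  open DeletionBound bound
  open SampleSize sample
  X = V P 3
  instance
    2X≢0 : NonZero (2 * X)
    2X≢0 = m*n≢0 2 X {{_}} {{falling³-nonZero (≤-trans 3≤m m≤V)}}
  2m≤3s : 2 * m ≤ 3 * s
  2m≤3s = *-cancelʳ-≤ (2 * m) (3 * s) (2 * X) (+-cancelʳ-≤ (2 * m * X) _ _ (begin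
    2 * m * (2 * X) + 2 * m * X ≡⟨ split-six m X ⟩
    6 * m * X                   ≤⟨ sampled m 3≤m m≤V ⟩
    6 * s * X + V * N * (m P 3) ≤⟨ +-monoʳ-≤ (6 * s * X) sparse ⟩
    6 * s * X + 2 * m * X       ≡⟨ cong (_+ 2 * m * X) (regroup s X) ⟩
    3 * s * (2 * X) + 2 * m * X ∎))
    where
    split-six : ∀ m X → 2 * m * (2 * X) + 2 * m * X ≡ 6 * m * X
    split-six = solve-∀
    regroup : ∀ s X → 6 * s * X ≡ 3 * s * (2 * X)
    regroup = solve-∀
  double-square : ∀ N m → 4 * (N * (m * m)) ≡ N * ((2 * m) * (2 * m))
  double-square = solve-∀
  triple-square : ∀ N s → N * ((3 * s) * (3 * s)) ≡ 9 * (s * s) * N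
  triple-square = solve-∀

deletion-size-bound-dense : ∀ {V t N s} → DeletionBound V t s → 2 ≤ V → 2 * (V * V) ≤ 9 * N → 8 * (V * V) ≤ 9 * (s * s) * N
deletion-size-bound-dense {V} {t} {N} {s} bound 2≤V dense = begin
  8 * (V * V)       ≡⟨ *-assoc 4 2 (V * V) ⟩
  4 * (2 * (V * V)) ≤⟨ *-monoʳ-≤ 4 dense ⟩
  4 * (9 * N)       ≡⟨ regroup N ⟩
  9 * (2 * 2) * N   ≤⟨ *-monoˡ-≤ N (*-monoʳ-≤ 9 (*-mono-≤ 2≤s 2≤s)) ⟩
  9 * (s * s) * N   ∎
  where
  open ≤-Reasoning
  2≤s = DeletionBound.keeps-pair bound 2≤V
  regroup : ∀ N → 4 * (9 * N) ≡ 9 * (2 * 2) * N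
  regroup = solve-∀

crossing : ∀ {P : ℕ → Set} → Decidable P → ∀ {a b} → a ≤ b → ¬ P a → P b →
  ∃ λ c → a ≤ c × c < b × ¬ P c × P (suc c)
crossing P? {b = zero}  z≤n ¬P0 P0 = contradiction P0 ¬P0
crossing P? {a} {suc b} a≤1+b ¬Pa P[1+b] with m≤n⇒m<n∨m≡n a≤1+b | P? b
... | inj₂ refl      | _      = contradiction P[1+b] ¬Pa
... | inj₁ (s≤s a≤b) | no ¬Pb = b , a≤b , ≤-refl , ¬Pb , P[1+b]
... | inj₁ (s≤s a≤b) | yes Pb with crossing P? a≤b ¬Pa Pb
...   | c , a≤c , c<b , ¬Pc , P[1+c] = c , a≤c , m≤n⇒m≤1+n c<b , ¬Pc , P[1+c]

falling-gap : ∀ {a V N} → 36 ≤ N → 3 ≤ a → 3 ≤ V →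
  N * (a * a) < 2 * (V * V) → 2 * (V * V) ≤ N * (suc a * suc a) →
  N * (a * (a ∸ 1)) ≤ 2 * ((V ∸ 1) * (V ∸ 2))
falling-gap {a@(suc a-1)} {V@(suc (suc (suc c)))} {N} 36≤N 3≤a@(s≤s (s≤s (s≤s _))) (s≤s (s≤s (s≤s _))) below above =
  +-cancelʳ-≤ (6 * V) _ _ (<⇒≤ (begin-strict
    N * (a * a-1) + 6 * V      ≤⟨ +-monoʳ-≤ (N * (a * a-1)) 6V≤Na ⟩
    N * (a * a-1) + N * a      ≡⟨ square-split N a-1 ⟩
    N * (a * a)                <⟨ below ⟩
    2 * (V * V)                ≤⟨ m≤m+n (2 * (V * V)) 4 ⟩
    2 * (V * V) + 4            ≡⟨ square-shift c ⟩
    2 * ((2 + c) * (1 + c)) + 6 * V ∎))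
  where
  open ≤-Reasoning
  square-split : ∀ N b → N * (suc b * b) + N * suc b ≡ N * (suc b * suc b)
  square-split = solve-∀
  square-shift : ∀ c → 2 * ((3 + c) * (3 + c)) + 4 ≡ 2 * ((2 + c) * (1 + c)) + 6 * (3 + c)
  square-shift = solve-∀
  8V≤N[a+1] : 8 * V ≤ N * suc a
  8V≤N[a+1] = ≮⇒≥ λ N[a+1]<8V → <⇒≱ (*-mono-< N[a+1]<8V N[a+1]<8V) (begin
    (8 * V) * (8 * V)             ≡⟨ regroup-64 V ⟩
    64 * (V * V)                  ≤⟨ *-monoˡ-≤ (V * V) (m≤m+n 64 8) ⟩
    72 * (V * V)                  ≡⟨ *-assoc 36 2 (V * V) ⟩
    36 * (2 * (V * V))            ≤⟨ *-mono-≤ 36≤N above ⟩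
    N * (N * (suc a * suc a))     ≡⟨ regroup-N N (suc a) ⟩
    (N * suc a) * (N * suc a)     ∎)
    where
    regroup-64 : ∀ V → (8 * V) * (8 * V) ≡ 64 * (V * V)
    regroup-64 = solve-∀
    regroup-N : ∀ N b → N * (N * (b * b)) ≡ (N * b) * (N * b)
    regroup-N = solve-∀
  6V≤Na : 6 * V ≤ N * a
  6V≤Na with 2 * V ≤? N
  ... | yes 2V≤N = begin
    6 * V       ≡⟨ *-assoc 3 2 V ⟩
    3 * (2 * V) ≤⟨ *-monoʳ-≤ 3 2V≤N ⟩
    3 * N       ≤⟨ *-monoˡ-≤ N 3≤a ⟩
    a * N       ≡⟨ *-comm a N ⟩
    N * a       ∎
  ... | no 2V≰N = +-cancelʳ-≤ (2 * V) _ _ (begin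
    6 * V + 2 * V ≡⟨ *-distribʳ-+ V 6 2 ⟨
    8 * V         ≤⟨ 8V≤N[a+1] ⟩
    N * suc a     ≡⟨ trans (*-suc N a) (+-comm N (N * a)) ⟩
    N * a + N     ≤⟨ +-monoʳ-≤ (N * a) (<⇒≤ (≰⇒> 2V≰N)) ⟩
    N * a + 2 * V ∎)

sparse-of-gap : ∀ {a V N} → 3 ≤ a → 3 ≤ V →
  N * (a * (a ∸ 1)) ≤ 2 * ((V ∸ 1) * (V ∸ 2)) → V * N * (suc a P 3) ≤ 2 * suc a * (V P 3)
sparse-of-gap {a@(suc (suc (suc i)))} {V@(suc (suc (suc c)))} {N} (s≤s (s≤s (s≤s _))) (s≤s (s≤s (s≤s _))) gap = begin
  V * N * (suc a P 3)                     ≡⟨ expand-sample c N i ⟩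
  (V * suc a) * (N * (a * (a ∸ 1)))       ≤⟨ *-monoʳ-≤ (V * suc a) gap ⟩
  (V * suc a) * (2 * ((V ∸ 1) * (V ∸ 2))) ≡⟨ expand-whole c i ⟩
  2 * suc a * (V P 3)                     ∎
  where
  open ≤-Reasoning
  expand-sample : ∀ c N i → (3 + c) * N * ((2 + i) * ((3 + i) * ((4 + i) * 1))) ≡ ((3 + c) * (4 + i)) * (N * ((3 + i) * (2 + i)))
  expand-sample = solve-∀
  expand-whole : ∀ c i → ((3 + c) * (4 + i)) * (2 * ((2 + c) * (1 + c))) ≡ 2 * (4 + i) * ((1 + c) * ((2 + c) * ((3 + c) * 1)))
  expand-whole = solve-∀

sample-size-exists : ∀ {V N} → 36 ≤ N → 9 * N < 2 * (V * V) → SampleSize V N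
sample-size-exists {V} {N} 36≤N sparse-graph =
  sample-at-crossing (crossing (λ m → 2 * (V * V) ≤? N * (m * m)) 3≤V ¬covers-3 covers-V)
  where
  3≤V : 3 ≤ V
  3≤V = ≰⇒> λ V≤2 → <⇒≱ sparse-graph
    (≤-trans (*-monoʳ-≤ 2 (*-mono-≤ V≤2 V≤2)) (≤-trans (m≤m+n 8 316) (*-monoʳ-≤ 9 36≤N)))
  ¬covers-3 : ¬ (2 * (V * V) ≤ N * (3 * 3))
  ¬covers-3 covers-3 = <⇒≱ sparse-graph (≤-trans covers-3 (≤-reflexive (*-comm N 9)))
  covers-V : 2 * (V * V) ≤ N * (V * V)
  covers-V = *-monoˡ-≤ (V * V) (≤-trans (m≤m+n 2 34) 36≤N)
  sample-at-crossing : ∃ (λ a → 3 ≤ a × a < V × ¬ (2 * (V * V) ≤ N * (a * a)) × 2 * (V * V) ≤ N * (suc a * suc a)) →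
    SampleSize V N
  sample-at-crossing (a , 3≤a , a<V , ¬covers-a , covers-a+1) = record
    { m      = suc a
    ; 3≤m    = m≤n⇒m≤1+n 3≤a
    ; m≤V    = a<V
    ; covers = covers-a+1
    ; sparse = sparse-of-gap 3≤a 3≤V (falling-gap 36≤N 3≤a 3≤V (≰⇒> ¬covers-a) covers-a+1)
    }

-- Binomial coefficients

nCk>0 : ∀ {n k} → k ≤ n → 0 < n C k
nCk>0 {k = zero}          _         = s≤s z≤n
nCk>0 {suc n} {suc k} (s≤s k≤n) =
  subst (0 <_) (nCk+nC[k+1]≡[n+1]C[k+1] n k) (≤-trans (nCk>0 k≤n) (m≤m+n _ _))

n≤nCk : ∀ {n k} → 0 < k → k < n → n ≤ n C k
n≤nCk {suc n} {1}           _ _           = ≤-reflexive (sym (nC1≡n (suc n)))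
n≤nCk {suc n} {suc (suc k)} _ (s≤s 1+k<n) = begin
  suc n                        ≡⟨ +-comm 1 n ⟩
  n + 1                        ≤⟨ +-mono-≤ (n≤nCk (s≤s z≤n) 1+k<n) (nCk>0 1+k<n) ⟩
  n C suc k + n C suc (suc k)  ≡⟨ nCk+nC[k+1]≡[n+1]C[k+1] n (suc k) ⟩
  suc n C suc (suc k)          ∎
  where open ≤-Reasoning

n+n≤[1+n]C[1+k] : ∀ {n k} → 0 < k → suc k < n → n + n ≤ suc n C suc k
n+n≤[1+n]C[1+k] {n} {k} 0<k 1+k<n = begin
  n + n               ≤⟨ +-mono-≤ (n≤nCk 0<k (<-trans (n<1+n k) 1+k<n)) (n≤nCk (s≤s z≤n) 1+k<n) ⟩
  n C k + n C suc k   ≡⟨ nCk+nC[k+1]≡[n+1]C[k+1] n k ⟩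
  suc n C suc k       ∎
  where open ≤-Reasoning

-- The hypercube

vertices : ∀ n → List (Vertex n)
vertices zero    = [ [] ]
vertices (suc n) = map (false ∷_) (vertices n) ++ map (true ∷_) (vertices n)

length-vertices : ∀ n → length (vertices n) ≡ 2 ^ n
length-vertices zero    = refl
length-vertices (suc n) = begin
  length (map (false ∷_) (vertices n) ++ map (true ∷_) (vertices n))
    ≡⟨ length-++ (map (false ∷_) (vertices n)) ⟩
  length (map (false ∷_) (vertices n)) + length (map (true ∷_) (vertices n))
    ≡⟨ cong₂ _+_ (length-map (false ∷_) (vertices n)) (length-map (true ∷_) (vertices n)) ⟩
  length (vertices n) + length (vertices n)
    ≡⟨ cong (λ l → l + l) (length-vertices n) ⟩
  2 ^ n + 2 ^ n
    ≡⟨ cong (2 ^ n +_) (sym (+-identityʳ (2 ^ n))) ⟩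
  2 ^ suc n ∎
  where open ≡-Reasoning

vertices-unique : ∀ n → Unique (vertices n)
vertices-unique zero    = [] ∷ []
vertices-unique (suc n) =
  Unique.++⁺ (Unique.map⁺ ∷-injectiveʳ (vertices-unique n)) (Unique.map⁺ ∷-injectiveʳ (vertices-unique n)) disjoint
  where
  disjoint : ∀ {v} → ¬ (v ∈ map (false ∷_) (vertices n) × v ∈ map (true ∷_) (vertices n))
  disjoint (v∈₀ , v∈₁) with ∈-map⁻ (false ∷_) v∈₀ | ∈-map⁻ (true ∷_) v∈₁
  ... | _ , _ , refl | _ , _ , ()

∑-vertices-suc : ∀ {n} c (f : Vertex (suc n) → ℕ) →
  ∑ (vertices (suc n)) f ≡ ∑[ z ∈ vertices n ] f (c ∷ z) + ∑[ z ∈ vertices n ] f (not c ∷ z)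
∑-vertices-suc {n} false f = begin
  ∑ (map (false ∷_) (vertices n) ++ map (true ∷_) (vertices n)) f
    ≡⟨ ∑-++ (map (false ∷_) (vertices n)) _ f ⟩
  ∑ (map (false ∷_) (vertices n)) f + ∑ (map (true ∷_) (vertices n)) f
    ≡⟨ cong₂ _+_ (∑-map (false ∷_) (vertices n) f) (∑-map (true ∷_) (vertices n) f) ⟩
  ∑[ z ∈ vertices n ] f (false ∷ z) + ∑[ z ∈ vertices n ] f (true ∷ z) ∎
  where open ≡-Reasoning
∑-vertices-suc true f =
  trans (∑-vertices-suc false f) (+-comm (∑[ z ∈ vertices _ ] f (false ∷ z)) _)

agreements : ∀ {n} → Vertex n → Vertex n → ℕ
agreements []      []      = 0
agreements (a ∷ x) (b ∷ y) = (1 ∸ bdiff a b) + agreements x y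

flips≢ flips≡ : ∀ {n} → Vertex n → Vertex n → Vertex n → ℕ
flips≢ []      []      []      = 0
flips≢ (a ∷ x) (b ∷ y) (c ∷ z) = bdiff a b * bdiff a c + flips≢ x y z
flips≡ []      []      []      = 0
flips≡ (a ∷ x) (b ∷ y) (c ∷ z) = (1 ∸ bdiff a b) * bdiff a c + flips≡ x y z

hamming-refl : ∀ {n} (x : Vertex n) → hamming x x ≡ 0
hamming-refl []          = refl
hamming-refl (false ∷ x) = hamming-refl x
hamming-refl (true  ∷ x) = hamming-refl x

hamming-sym : ∀ {n} (x y : Vertex n) → hamming x y ≡ hamming y x
hamming-sym []          []          = refl
hamming-sym (false ∷ x) (false ∷ y) = hamming-sym x y
hamming-sym (false ∷ x) (true  ∷ y) = cong suc (hamming-sym x y)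
hamming-sym (true  ∷ x) (false ∷ y) = cong suc (hamming-sym x y)
hamming-sym (true  ∷ x) (true  ∷ y) = hamming-sym x y

agreements-refl : ∀ {n} (x : Vertex n) → agreements x x ≡ n
agreements-refl []          = refl
agreements-refl (false ∷ x) = cong suc (agreements-refl x)
agreements-refl (true  ∷ x) = cong suc (agreements-refl x)

hamming+agreements : ∀ {n} (x y : Vertex n) → hamming x y + agreements x y ≡ n
hamming+agreements []          []          = refl
hamming+agreements (false ∷ x) (false ∷ y) = trans (+-suc _ _) (cong suc (hamming+agreements x y))
hamming+agreements (false ∷ x) (true  ∷ y) = cong suc (hamming+agreements x y)
hamming+agreements (true  ∷ x) (false ∷ y) = cong suc (hamming+agreements x y)
hamming+agreements (true  ∷ x) (true  ∷ y) = trans (+-suc _ _) (cong suc (hamming+agreements x y))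

flips≢-refl : ∀ {n} (x z : Vertex n) → flips≢ x x z ≡ 0
flips≢-refl []          []          = refl
flips≢-refl (false ∷ x) (c ∷ z) = flips≢-refl x z
flips≢-refl (true  ∷ x) (c ∷ z) = flips≢-refl x z

flips≡-refl : ∀ {n} (x z : Vertex n) → flips≡ x x z ≡ hamming x z
flips≡-refl []          []          = refl
flips≡-refl (false ∷ x) (false ∷ z) = flips≡-refl x z
flips≡-refl (false ∷ x) (true  ∷ z) = cong suc (flips≡-refl x z)
flips≡-refl (true  ∷ x) (false ∷ z) = cong suc (flips≡-refl x z)
flips≡-refl (true  ∷ x) (true  ∷ z) = flips≡-refl x z

hamming-via-flips : ∀ {n} (x y z : Vertex n) → hamming x z ≡ flips≢ x y z + flips≡ x y z
hamming-via-flips []          []          []          = refl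
hamming-via-flips (false ∷ x) (false ∷ y) (false ∷ z) = hamming-via-flips x y z
hamming-via-flips (false ∷ x) (false ∷ y) (true  ∷ z) = trans (cong suc (hamming-via-flips x y z)) (sym (+-suc _ _))
hamming-via-flips (false ∷ x) (true  ∷ y) (false ∷ z) = hamming-via-flips x y z
hamming-via-flips (false ∷ x) (true  ∷ y) (true  ∷ z) = cong suc (hamming-via-flips x y z)
hamming-via-flips (true  ∷ x) (false ∷ y) (false ∷ z) = cong suc (hamming-via-flips x y z)
hamming-via-flips (true  ∷ x) (false ∷ y) (true  ∷ z) = hamming-via-flips x y z
hamming-via-flips (true  ∷ x) (true  ∷ y) (false ∷ z) = trans (cong suc (hamming-via-flips x y z)) (sym (+-suc _ _))
hamming-via-flips (true  ∷ x) (true  ∷ y) (true  ∷ z) = hamming-via-flips x y z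

hamming-flips-balance : ∀ {n} (x y z : Vertex n) → hamming y z + flips≢ x y z ≡ hamming x y + flips≡ x y z
hamming-flips-balance []          []          []          = refl
hamming-flips-balance (false ∷ x) (false ∷ y) (false ∷ z) = hamming-flips-balance x y z
hamming-flips-balance (false ∷ x) (false ∷ y) (true  ∷ z) = trans (cong suc (hamming-flips-balance x y z)) (sym (+-suc _ _))
hamming-flips-balance (false ∷ x) (true  ∷ y) (false ∷ z) = cong suc (hamming-flips-balance x y z)
hamming-flips-balance (false ∷ x) (true  ∷ y) (true  ∷ z) = trans (+-suc _ _) (cong suc (hamming-flips-balance x y z))
hamming-flips-balance (true  ∷ x) (false ∷ y) (false ∷ z) = trans (+-suc _ _) (cong suc (hamming-flips-balance x y z))
hamming-flips-balance (true  ∷ x) (false ∷ y) (true  ∷ z) = cong suc (hamming-flips-balance x y z)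
hamming-flips-balance (true  ∷ x) (true  ∷ y) (false ∷ z) = trans (cong suc (hamming-flips-balance x y z)) (sym (+-suc _ _))
hamming-flips-balance (true  ∷ x) (true  ∷ y) (true  ∷ z) = hamming-flips-balance x y z

hasProfile : ∀ {n} → Vertex n → Vertex n → ℕ → ℕ → Vertex n → ℕ
hasProfile x y a b z = δ (flips≢ x y z) a * δ (flips≡ x y z) b

mutual
  count-flips : ∀ {n} (x y : Vertex n) a b →
    ∑ (vertices n) (hasProfile x y a b) ≡ (hamming x y C a) * (agreements x y C b)
  count-flips []          []          zero    zero    = refl
  count-flips []          []          zero    (suc b) = refl
  count-flips []          []          (suc a) b       = refl
  count-flips (false ∷ x) (false ∷ y) a b =
    trans (∑-vertices-suc false (hasProfile (false ∷ x) (false ∷ y) a b)) (count-flips-agreeing x y a b)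
  count-flips (true  ∷ x) (true  ∷ y) a b =
    trans (∑-vertices-suc true (hasProfile (true ∷ x) (true ∷ y) a b)) (count-flips-agreeing x y a b)
  count-flips (false ∷ x) (true  ∷ y) a b =
    trans (∑-vertices-suc false (hasProfile (false ∷ x) (true ∷ y) a b)) (count-flips-differing x y a b)
  count-flips (true  ∷ x) (false ∷ y) a b =
    trans (∑-vertices-suc true (hasProfile (true ∷ x) (false ∷ y) a b)) (count-flips-differing x y a b)

  count-flips-agreeing : ∀ {n} (x y : Vertex n) a b →
    ∑ (vertices n) (hasProfile x y a b) +
    ∑[ z ∈ vertices n ] (δ (flips≢ x y z) a * δ (suc (flips≡ x y z)) b)
      ≡ (hamming x y C a) * (suc (agreements x y) C b)
  count-flips-agreeing {n} x y a zero =
    trans (cong₂ _+_ (count-flips x y a 0) (∑-zero (vertices n) (λ z → *-zeroʳ (δ (flips≢ x y z) a)))) (+-identityʳ _)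
  count-flips-agreeing x y a (suc b) = begin
    _ ≡⟨ cong₂ _+_ (count-flips x y a (suc b)) (count-flips x y a b) ⟩
    (h C a) * (g C suc b) + (h C a) * (g C b) ≡⟨ +-comm _ ((h C a) * (g C b)) ⟩
    (h C a) * (g C b) + (h C a) * (g C suc b) ≡⟨ *-distribˡ-+ (h C a) _ _ ⟨
    (h C a) * (g C b + g C suc b)             ≡⟨ cong ((h C a) *_) (nCk+nC[k+1]≡[n+1]C[k+1] g b) ⟩
    (h C a) * (suc g C suc b)                 ∎
    where
    open ≡-Reasoning
    h = hamming x y
    g = agreements x y

  count-flips-differing : ∀ {n} (x y : Vertex n) a b →
    ∑ (vertices n) (hasProfile x y a b) +
    ∑[ z ∈ vertices n ] (δ (suc (flips≢ x y z)) a * δ (flips≡ x y z) b)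
      ≡ (suc (hamming x y) C a) * (agreements x y C b)
  count-flips-differing {n} x y zero b =
    trans (cong₂ _+_ (count-flips x y 0 b) (∑-zero (vertices n) {λ _ → 0} (λ _ → refl))) (+-identityʳ _)
  count-flips-differing x y (suc a) b = begin
    _ ≡⟨ cong₂ _+_ (count-flips x y (suc a) b) (count-flips x y a b) ⟩
    (h C suc a) * (g C b) + (h C a) * (g C b) ≡⟨ +-comm _ ((h C a) * (g C b)) ⟩
    (h C a) * (g C b) + (h C suc a) * (g C b) ≡⟨ *-distribʳ-+ (g C b) (h C a) _ ⟨
    (h C a + h C suc a) * (g C b)             ≡⟨ cong (_* (g C b)) (nCk+nC[k+1]≡[n+1]C[k+1] h a) ⟩
    (suc h C suc a) * (g C b)                 ∎
    where
    open ≡-Reasoning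
    h = hamming x y
    g = agreements x y

triangle : ℕ → ∀ {n} → Vertex n → Vertex n → Vertex n → ℕ
triangle r x y z = δ (hamming x y) r * (δ (hamming y z) r * δ (hamming x z) r)

neighbour-count : ∀ {n} (x : Vertex n) r → ∑[ y ∈ vertices n ] δ (hamming x y) r ≡ n C r
neighbour-count {n} x r = begin
  ∑[ y ∈ vertices n ] δ (hamming x y) r   ≡⟨ ∑-cong (vertices n) profile ⟩
  ∑ (vertices n) (hasProfile x x 0 r)     ≡⟨ count-flips x x 0 r ⟩
  (hamming x x C 0) * (agreements x x C r) ≡⟨ cong (λ g → 1 * (g C r)) (agreements-refl x) ⟩
  1 * (n C r)                             ≡⟨ *-identityˡ (n C r) ⟩
  n C r                                   ∎
  where
  open ≡-Reasoning
  profile : ∀ y → δ (hamming x y) r ≡ hasProfile x x 0 r y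
  profile y rewrite flips≢-refl x y | flips≡-refl x y = sym (*-identityˡ _)

common-neighbour-count : ∀ {n} (x y : Vertex n) k → hamming x y ≡ 2 * k →
  ∑[ z ∈ vertices n ] (δ (hamming y z) (2 * k) * δ (hamming x z) (2 * k)) ≡ ((2 * k) C k) * ((n ∸ 2 * k) C k)
common-neighbour-count {n} x y k x~y = begin
  ∑[ z ∈ vertices n ] (δ (hamming y z) (2 * k) * δ (hamming x z) (2 * k))
    ≡⟨ ∑-cong (vertices n) profile ⟩
  ∑ (vertices n) (hasProfile x y k k)
    ≡⟨ count-flips x y k k ⟩
  (hamming x y C k) * (agreements x y C k)
    ≡⟨ cong₂ (λ h g → (h C k) * (g C k)) x~y agreements≡ ⟩
  ((2 * k) C k) * ((n ∸ 2 * k) C k) ∎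
  where
  open ≡-Reasoning
  agreements≡ : agreements x y ≡ n ∸ 2 * k
  agreements≡ = trans (sym (m+n∸m≡n (hamming x y) _)) (cong₂ _∸_ (hamming+agreements x y) x~y)
  profile : ∀ z → δ (hamming y z) (2 * k) * δ (hamming x z) (2 * k) ≡ hasProfile x y k k z
  profile z = indicator-unique
    (*-indicator (δ-indicator (hamming y z) _) (δ-indicator (hamming x z) _))
    (*-indicator (δ-indicator (flips≢ x y z) k) (δ-indicator (flips≡ x y z) k))
    to from
    where
    via-flips = hamming-via-flips x y z
    balance   = hamming-flips-balance x y z
    to : hamming y z ≡ 2 * k × hamming x z ≡ 2 * k → flips≢ x y z ≡ k × flips≡ x y z ≡ k
    to (y~z , x~z) = f₁≡k , trans (sym f₁≡f₂) f₁≡k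
      where
      f₁≡f₂ : flips≢ x y z ≡ flips≡ x y z
      f₁≡f₂ = +-cancelˡ-≡ (2 * k) _ _
        (trans (cong (_+ flips≢ x y z) (sym y~z)) (trans balance (cong (_+ flips≡ x y z) x~y)))
      f₁≡k : flips≢ x y z ≡ k
      f₁≡k = *-cancelˡ-≡ _ k 2
        (trans (cong (flips≢ x y z +_) (trans (+-identityʳ _) f₁≡f₂)) (trans (sym via-flips) x~z))
    from : flips≢ x y z ≡ k × flips≡ x y z ≡ k → hamming y z ≡ 2 * k × hamming x z ≡ 2 * k
    from (f₁≡k , f₂≡k) =
      +-cancelʳ-≡ k _ _ (trans (cong (hamming y z +_) (sym f₁≡k)) (trans balance (cong₂ _+_ x~y f₂≡k))) ,
      trans via-flips (trans (cong₂ _+_ f₁≡k f₂≡k) (cong (k +_) (sym (+-identityʳ k))))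

triangles-through : ∀ {n} (x : Vertex n) {r} k → r ≡ 2 * k →
  ∑[ y ∈ vertices n ] ∑[ z ∈ vertices n ] triangle r x y z ≡ (n C r) * (r C k) * ((n ∸ r) C k)
triangles-through {n} x k refl = begin
  ∑[ y ∈ vertices n ] ∑[ z ∈ vertices n ] triangle r x y z
    ≡⟨ ∑-cong (vertices n) (λ y → ∑-*ˡ (vertices n) (δ (hamming x y) r) _) ⟩
  ∑[ y ∈ vertices n ] (δ (hamming x y) r * common y)
    ≡⟨ ∑-cong (vertices n) common≡M ⟩
  ∑[ y ∈ vertices n ] (M * δ (hamming x y) r)
    ≡⟨ ∑-*ˡ (vertices n) M _ ⟩
  M * ∑[ y ∈ vertices n ] δ (hamming x y) r
    ≡⟨ cong (M *_) (neighbour-count x r) ⟩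
  M * (n C r)
    ≡⟨ *-comm M (n C r) ⟩
  (n C r) * M
    ≡⟨ *-assoc (n C r) _ _ ⟨
  (n C r) * (r C k) * ((n ∸ r) C k) ∎
  where
  open ≡-Reasoning
  r = 2 * k
  M = (r C k) * ((n ∸ r) C k)
  common : Vertex n → ℕ
  common y = ∑[ z ∈ vertices n ] (δ (hamming y z) r * δ (hamming x z) r)
  common≡M : ∀ y → δ (hamming x y) r * common y ≡ M * δ (hamming x y) r
  common≡M y with δ-indicator (hamming x y) r
  ... | inj₁ (x~y , δ≡1) rewrite δ≡1 =
    trans (*-identityˡ (common y)) (trans (common-neighbour-count x y k x~y) (sym (*-identityʳ M)))
  ... | inj₂ (_ , δ≡0) rewrite δ≡0 = sym (*-zeroʳ M)

triangle-swap₁₂ : ∀ r {n} (x y z : Vertex n) → triangle r x y z ≡ triangle r y x z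
triangle-swap₁₂ r x y z rewrite hamming-sym y x =
  cong (δ (hamming x y) r *_) (*-comm (δ (hamming y z) r) (δ (hamming x z) r))

triangle-swap₂₃ : ∀ r {n} (x y z : Vertex n) → triangle r x y z ≡ triangle r x z y
triangle-swap₂₃ r x y z rewrite hamming-sym z y = reverse (δ (hamming x y) r) (δ (hamming y z) r) (δ (hamming x z) r)
  where
  reverse : ∀ a b c → a * (b * c) ≡ c * (b * a)
  reverse = solve-∀

triangle-diag : ∀ {r} → 0 < r → ∀ {n} (x z : Vertex n) → triangle r x x z ≡ 0
triangle-diag {suc r} _ x z rewrite hamming-refl x = refl

module HypercubeDeletion {r} (0<r : 0 < r) {n : ℕ} where

  open Deletion (triangle r {n}) (triangle-swap₁₂ r) (triangle-swap₂₃ r) (triangle-diag 0<r) public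

  triangle-free : ∀ {S} → triangles S ≡ 0 → TriangleFree r S
  triangle-free {S} S-free x y z x∈S y∈S z∈S (x~y , y~z , x~z) = 1≢0 (n≤0⇒n≡0 (begin
    1                  ≡⟨ triangle≡1 ⟨
    triangle r x y z   ≤⟨ ∈⇒T≤triangles x∈S y∈S z∈S ⟩
    triangles S        ≡⟨ S-free ⟩
    0                  ∎))
    where
    open ≤-Reasoning
    1≢0 : ¬ 1 ≡ 0
    1≢0 ()
    triangle≡1 : triangle r x y z ≡ 1
    triangle≡1 rewrite x~y | y~z | x~z | δ-refl r = refl

  triangles-vertices : ∀ k → r ≡ 2 * k → triangles (vertices n) ≡ 2 ^ n * ((n C r) * (r C k) * ((n ∸ r) C k))
  triangles-vertices k r≡2k = begin
    ∑ (vertices n) (degree (vertices n))           ≡⟨ ∑-cong (vertices n) (λ x → triangles-through x k r≡2k) ⟩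
    ∑[ _ ∈ vertices n ] N                          ≡⟨ ∑-const (vertices n) N ⟩
    length (vertices n) * N                        ≡⟨ cong (_* N) (length-vertices n) ⟩
    2 ^ n * N                                      ∎
    where
    open ≡-Reasoning
    N = (n C r) * (r C k) * ((n ∸ r) C k)

central-binomial≥6 : ∀ j → 6 ≤ (2 * (2 + j)) C (2 + j)
central-binomial≥6 j = ≤-trans (+-mono-≤ 3≤a 3≤a) (n+n≤[1+n]C[1+k] {a} {suc j} (s≤s z≤n) 3+j≤a)
  where
  a = pred (2 * (2 + j))
  3+j≤a : 3 + j ≤ a
  3+j≤a = s≤s (≤-trans (≤-reflexive (cong (2 +_) (sym (+-identityʳ j)))) (m≤n+m (2 + (j + 0)) j))
  3≤a : 3 ≤ a
  3≤a = ≤-trans (m≤m+n 3 j) 3+j≤a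

36≤triangles-through : ∀ {n k} → 0 < k → 3 * k ≤ n → 5 ≤ n →
  36 ≤ (n C (2 * k)) * ((2 * k) C k) * ((n ∸ 2 * k) C k)
36≤triangles-through {suc a} {1} _ _ (s≤s 4≤a) = begin
  36                                        ≤⟨ m≤m+n 36 12 ⟩
  8 * 2 * 3                                 ≤⟨ *-mono-≤ (*-monoˡ-≤ 2 8≤[1+a]C2) 3≤[a-1]C1 ⟩
  (suc a C 2) * (2 C 1) * ((suc a ∸ 2) C 1) ∎
  where
  open ≤-Reasoning
  8≤[1+a]C2 : 8 ≤ suc a C 2
  8≤[1+a]C2 = ≤-trans (+-mono-≤ 4≤a 4≤a) (n+n≤[1+n]C[1+k] (s≤s z≤n) (≤-trans (s≤s (s≤s (s≤s z≤n))) 4≤a))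
  3≤[a-1]C1 : 3 ≤ (suc a ∸ 2) C 1
  3≤[a-1]C1 = subst (3 ≤_) (sym (nC1≡n (suc a ∸ 2))) (∸-monoˡ-≤ 2 (s≤s 4≤a))
36≤triangles-through {n} {k@(suc (suc j))} _ 3k≤n _ = begin
  36                                                ≤⟨ *-mono-≤ (*-mono-≤ 6≤nC2k (central-binomial≥6 j)) (nCk>0 k≤n∸2k) ⟩
  (n C (2 * k)) * ((2 * k) C k) * ((n ∸ 2 * k) C k) ∎
  where
  open ≤-Reasoning
  2k<n : 2 * k < n
  2k<n = <-≤-trans (*-monoˡ-< k (n<1+n 2)) 3k≤n
  6≤nC2k : 6 ≤ n C (2 * k)
  6≤nC2k = ≤-trans (≤-trans (*-monoʳ-≤ 3 (s≤s (s≤s z≤n))) 3k≤n) (n≤nCk (s≤s z≤n) 2k<n)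
  k≤n∸2k : k ≤ n ∸ 2 * k
  k≤n∸2k = m+n≤o⇒m≤o∸n k 3k≤n

-- For n ∈ {3, 4} we have N < 36, so `sample-size-exists` does not apply and m = 5 is checked directly.
small-cube-sample-size : ∀ {n k} → 0 < k → 3 * k ≤ n → n < 5 →
  SampleSize (2 ^ n) ((n C (2 * k)) * ((2 * k) C k) * ((n ∸ 2 * k) C k))
small-cube-sample-size {3} {1} _ _ _ = record
  { m = 5 ; 3≤m = ≤ᵇ⇒≤ 3 5 tt ; m≤V = ≤ᵇ⇒≤ 5 8 tt ; covers = ≤ᵇ⇒≤ _ _ tt ; sparse = ≤ᵇ⇒≤ _ _ tt }
small-cube-sample-size {4} {1} _ _ _ = record
  { m = 5 ; 3≤m = ≤ᵇ⇒≤ 3 5 tt ; m≤V = ≤ᵇ⇒≤ 5 16 tt ; covers = ≤ᵇ⇒≤ _ _ tt ; sparse = ≤ᵇ⇒≤ _ _ tt }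
small-cube-sample-size {n} {suc (suc k)} _ 3k≤n n<5 =
  contradiction (≤-trans (*-monoʳ-≤ 3 (s≤s (s≤s z≤n))) 3k≤n) (<⇒≱ (≤-trans n<5 (≤ᵇ⇒≤ 5 6 tt)))
small-cube-sample-size {0} {1} _ () _
small-cube-sample-size {1} {1} _ (s≤s ()) _
small-cube-sample-size {2} {1} _ (s≤s (s≤s ())) _
small-cube-sample-size {suc (suc (suc (suc (suc n))))} {1} _ _ (s≤s (s≤s (s≤s (s≤s (s≤s ())))))

cube-sample-size : ∀ {n k} → 0 < k → 3 * k ≤ n →
  let N = (n C (2 * k)) * ((2 * k) C k) * ((n ∸ 2 * k) C k) in
  9 * N < 2 * (2 ^ n * 2 ^ n) → SampleSize (2 ^ n) N
cube-sample-size {n} 0<k 3k≤n sparse with 5 ≤? n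
... | yes 5≤n = sample-size-exists (36≤triangles-through 0<k 3k≤n 5≤n) sparse
... | no  5≰n = small-cube-sample-size 0<k 3k≤n (≰⇒> 5≰n)

4^n≡2^n*2^n : ∀ n → 4 ^ n ≡ 2 ^ n * 2 ^ n
4^n≡2^n*2^n n = trans (^-*-assoc 2 2 n) (trans (cong (λ m → 2 ^ (n + m)) (+-identityʳ n)) (^-distribˡ-+-* 2 n n))

mainTheorem2 : (n r k : ℕ) → 0 < n → 0 < r → r ≡ 2 * k → 3 * r ≤ 2 * n →
    Σ (List (Vertex n)) (λ S → Unique S × TriangleFree r S ×
      8 * 4 ^ n ≤ 9 * (length S * length S) * ((n C r) * (r C k) * ((n ∸ r) C k)))
mainTheorem2 n .(2 * k) k 0<n 0<2k refl 6k≤2n = from-survivors (deletion (vertices n))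
  where
  open HypercubeDeletion 0<2k {n}
  V = 2 ^ n
  N = (n C (2 * k)) * ((2 * k) C k) * ((n ∸ 2 * k) C k)
  3k≤n : 3 * k ≤ n
  3k≤n = *-cancelˡ-≤ 2 (≤-trans (≤-reflexive (trans (sym (*-assoc 2 3 k)) (*-assoc 3 2 k))) 6k≤2n)
  from-survivors : Survivors (vertices n) →
    Σ (List (Vertex n)) (λ S → Unique S × TriangleFree (2 * k) S × 8 * 4 ^ n ≤ 9 * (length S * length S) * N)
  from-survivors (S , S⊆vertices , S-free , bound) =
    S , Unique-⊆ S⊆vertices (vertices-unique n) , triangle-free S-free ,
    subst (λ W → 8 * W ≤ 9 * (length S * length S) * N) (sym (4^n≡2^n*2^n n)) size
    where
    bound′ : DeletionBound V (V * N) (length S)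
    bound′ = subst₂ (λ V t → DeletionBound V t (length S)) (length-vertices n) (triangles-vertices k refl) bound
    size : 8 * (V * V) ≤ 9 * (length S * length S) * N
    size with 2 * (V * V) ≤? 9 * N
    ... | yes dense  = deletion-size-bound-dense bound′ (^-monoʳ-≤ 2 0<n) dense
    ... | no  sparse = deletion-size-bound bound′ (cube-sample-size (*-cancelˡ-< 2 0 k 0<2k) 3k≤n (≰⇒> sparse))
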